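{- Let $k\geq 1$, $n=8k+r$ with $r\in\{7,8\}$, $G=C(n,\pm\{1,2,3,4\})$, $a\in\mathbb{Z}_n$, $1\leq\ell\leq k$, and $\varepsilon\in\{+1,-1\}$. Let $A=(\{a,a+\varepsilon\},\{a+\varepsilon(2+4\ell),a+\varepsilon(3+4\ell),a+\varepsilon(4+4\ell)\})$ (indices mod $n$) be an $S$-cluster for some $S\subseteq V(G)$. If $X\subseteq V(G)\setminus\{a-\varepsilon 4k,\,a-\varepsilon4(k-1),\dots,a-\varepsilon4(k-\ell+1)\}$ resolves $A$, then $|X|\geq 3$.
   Context: $C(n,\pm\{1,2,3,4\})$ is the graph on $\mathbb{Z}_n$ where distinct $i,j$ are adjacent iff $j-i\equiv\pm s\pmod n$ for some $s\in\{1,2,3,4\}$; $d$ is graph distance, and $r(v|X)=(d(v,x))_{x\in X}$. For $S\subseteq V$, a set $B$ is an $S$-block if $r(a|S)=r(b|S)$ for all $a,b\in B$. A tuple $(A_1,\dots,A_p)$ of $S$-blocks is an $S$-cluster if the $A_i$ are contained in distinct equivalence classes of $u\sim_S v\iff r(u|S)=r(v|S)$. A set $X$ resolves a tuple $(A_1,\dots,A_p)$ if $r(a|X)\neq r(b|X)$ for all distinct $a,b$ in the same $A_j$. -}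

module Defs where

open import Data.Nat using (ℕ; zero; suc; _+_; _*_; _∸_; _<_; _≤_; NonZero)
open import Data.Nat.DivMod using (_%_; _mod_)
open import Data.Integer as ℤ using (ℤ; +_)
open import Data.Integer.DivMod using (_%ℕ_)
open import Data.Fin using (Fin; toℕ)
open import Data.Fin.Subset using (Subset; _∈_)
open import Data.List using (List; length; lookup)
open import Data.List.Membership.Propositional renaming (_∈_ to _∈ₗ_)
open import Data.List.Relation.Unary.All using (All)
open import Data.Product using (Σ; ∃; _×_)
open import Data.Sum using (_⊎_)
open import Relation.Binary.PropositionalEquality using (_≡_; _≢_)
open import Relation.Nullary using (¬_)

-- Vertex set of C(n, ±{1,2,3,4}) is Z_n = Fin n.
-- (j - i) mod n, as a natural number in [0, n)
diff : (n : ℕ) .{{_ : NonZero n}} → Fin n → Fin n → ℕ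
diff n i j = (toℕ j + (n ∸ toℕ i)) % n

Adj : (n : ℕ) .{{_ : NonZero n}} → Fin n → Fin n → Set
Adj n i j = i ≢ j × Σ ℕ (λ s → (1 ≤ s × s ≤ 4) × (diff n i j ≡ s ⊎ diff n i j ≡ (n ∸ s) % n))

Reach : (n : ℕ) .{{_ : NonZero n}} → ℕ → Fin n → Fin n → Set
Reach n zero    u v = u ≡ v
Reach n (suc m) u v = Reach n m u v ⊎ Σ (Fin n) (λ w → Adj n u w × Reach n m w v)

IsDist : (n : ℕ) .{{_ : NonZero n}} → Fin n → Fin n → ℕ → Set
IsDist n u v m = Reach n m u v × (∀ m' → m' < m → ¬ Reach n m' u v)

SameRep : (n : ℕ) .{{_ : NonZero n}} → Subset n → Fin n → Fin n → Set
SameRep n X u v = ∀ x → x ∈ X → ∀ m → (IsDist n u x m → IsDist n v x m) × (IsDist n v x m → IsDist n u x m)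

IsBlock : (n : ℕ) .{{_ : NonZero n}} → Subset n → List (Fin n) → Set
IsBlock n S B = ∀ a b → a ∈ₗ B → b ∈ₗ B → SameRep n S a b

IsCluster : (n : ℕ) .{{_ : NonZero n}} → Subset n → List (List (Fin n)) → Set
IsCluster n S As =
  All (IsBlock n S) As ×
  (∀ (i j : Fin (length As)) → i ≢ j → ∀ a b → a ∈ₗ lookup As i → b ∈ₗ lookup As j → ¬ SameRep n S a b)

Resolves : (n : ℕ) .{{_ : NonZero n}} → Subset n → List (List (Fin n)) → Set
Resolves n X As = ∀ B → B ∈ₗ As → ∀ a b → a ∈ₗ B → b ∈ₗ B → a ≢ b → ¬ SameRep n X a b

shift : (n : ℕ) .{{_ : NonZero n}} → Fin n → ℤ → Fin n
shift n a z = ((+ toℕ a ℤ.+ z) %ℕ n) mod n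

-- In C(n, ±{1,2,3,4}) the distance between two vertices is ⌈c/4⌉, where c is their
-- distance around the n-cycle.  Measure positions from a in the direction ε and let a
-- landmark x sit at offset t.  A case analysis on t mod 4, using n ∈ {8k+7, 8k+8} and
-- that x is none of the excluded vertices a − 4jε, shows that x is equidistant from a
-- and a + ε, or from all three of a + ε(2+4ℓ), a + ε(3+4ℓ), a + ε(4+4ℓ).  These three
-- vertices are pairwise adjacent, so their distances to any x take at most two values
-- and x is equidistant from two of them.  Hence two landmarks always leave some pair
-- of the cluster unresolved.

module Submission where

open import Defs
open import Data.Nat using (ℕ; zero; suc; _+_; _*_; _∸_; _≤_; _<_; NonZero; z≤n; s≤s; _≤?_; _<?_)
open import Data.Nat.Properties
open import Algebra.Properties.CommutativeSemigroup +-commutativeSemigroup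
  using (interchange; xy∙z≈xz∙y; x∙yz≈y∙xz; x∙yz≈xz∙y)
open import Data.Nat.DivMod
  using (_%_; _/_; _mod_; _divMod_; DivMod; result; m≡m%n+[m/n]*n; m%n<n; m<n⇒m%n≡m)
open import Data.Nat.Tactic.RingSolver using (solve-∀)
open import Data.Integer as ℤ using (ℤ; +_; -_; -[1+_]; _⊖_)
open import Data.Integer.DivMod using (_%ℕ_)
import Data.Integer.Properties as ℤₚ
open import Data.Fin using (Fin; toℕ; zero; suc)
open import Data.Fin.Properties using (toℕ<n; toℕ-injective; toℕ-fromℕ<)
open import Data.Fin.Subset using (Subset; _∈_; _∉_; ∣_∣; inside; outside)
open import Data.List using (List; []; _∷_; length; map)
open import Data.List.Properties using (length-map)
open import Data.List.Relation.Unary.All as All using (All; []; _∷_)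
open import Data.List.Relation.Unary.Any using (here; there)
open import Data.List.Membership.Propositional using () renaming (_∈_ to _∈ₗ_)
open import Data.List.Membership.Propositional.Properties using (∈-map⁺; ∈-map⁻)
open import Data.Vec using ([]; _∷_; here; there)
open import Data.Product using (∃; ∃₂; _×_; _,_; proj₁; proj₂; swap)
open import Data.Sum using (_⊎_; inj₁; inj₂)
import Data.Sum
open import Data.Empty using (⊥; ⊥-elim)
open import Function using (_∘_)
open import Function.Bundles using (_⇔_; mk⇔; Equivalence)
open import Function.Construct.Symmetry using (⇔-sym)
open Equivalence using (to; from)
open import Relation.Nullary using (¬_; Dec; yes; no)
open import Relation.Nullary.Decidable using (_⊎-dec_)
import Relation.Nullary.Decidable as Dec
open import Relation.Binary using (tri<; tri≈; tri>)
open import Relation.Binary.PropositionalEquality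

within-one⇒two-equal : ∀ {a b c} → a ≤ suc b → b ≤ suc a → b ≤ suc c → c ≤ suc b →
             a ≤ suc c → c ≤ suc a → a ≡ b ⊎ b ≡ c ⊎ a ≡ c
within-one⇒two-equal {a} {b} {c} a≤1+b b≤1+a b≤1+c c≤1+b a≤1+c c≤1+a with <-cmp a b
... | tri≈ _ a≡b _ = inj₁ a≡b
... | tri< a<b _ _ with <-cmp a c
...   | tri≈ _ a≡c _ = inj₂ (inj₂ a≡c)
...   | tri< a<c _ _ = inj₂ (inj₁ (trans (≤-antisym b≤1+a a<b) (sym (≤-antisym c≤1+a a<c))))
...   | tri> _ _ c<a = ⊥-elim (<⇒≱ c<a (≤-pred (≤-trans a<b b≤1+c)))
within-one⇒two-equal {a} {b} {c} a≤1+b b≤1+a b≤1+c c≤1+b a≤1+c c≤1+a | tri> _ _ b<a with <-cmp b c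
...   | tri≈ _ b≡c _ = inj₂ (inj₁ b≡c)
...   | tri< b<c _ _ = inj₂ (inj₂ (trans (≤-antisym a≤1+b b<a) (sym (≤-antisym c≤1+b b<c))))
...   | tri> _ _ c<b = ⊥-elim (<⇒≱ c<b (≤-pred (≤-trans b<a a≤1+c)))

members : ∀ {m} (X : Subset m) →
          ∃ λ L → length L ≡ ∣ X ∣ × (∀ {x} → x ∈ X → x ∈ₗ L) ×
                  (∀ {x} → x ∈ₗ L → x ∈ X)
members [] = [] , refl , (λ ()) , (λ ())
members (inside ∷ X) with members X
... | L , length≡ , ∈⇒∈ₗ , ∈ₗ⇒∈ =
  zero ∷ map suc L , cong suc (trans (length-map suc L) length≡) , ∈⇒∈ₗ′ , ∈ₗ⇒∈′
  where
  ∈⇒∈ₗ′ : ∀ {x} → x ∈ inside ∷ X → x ∈ₗ zero ∷ map suc L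
  ∈⇒∈ₗ′ here        = here refl
  ∈⇒∈ₗ′ (there x∈X) = there (∈-map⁺ suc (∈⇒∈ₗ x∈X))
  ∈ₗ⇒∈′ : ∀ {x} → x ∈ₗ zero ∷ map suc L → x ∈ inside ∷ X
  ∈ₗ⇒∈′ (here refl) = here
  ∈ₗ⇒∈′ (there x∈sucL) with ∈-map⁻ suc x∈sucL
  ... | _ , y∈L , refl = there (∈ₗ⇒∈ y∈L)
members (outside ∷ X) with members X
... | L , length≡ , ∈⇒∈ₗ , ∈ₗ⇒∈ =
  map suc L , trans (length-map suc L) length≡ , ∈⇒∈ₗ′ , ∈ₗ⇒∈′
  where
  ∈⇒∈ₗ′ : ∀ {x} → x ∈ outside ∷ X → x ∈ₗ map suc L
  ∈⇒∈ₗ′ (there x∈X) = ∈-map⁺ suc (∈⇒∈ₗ x∈X)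
  ∈ₗ⇒∈′ : ∀ {x} → x ∈ₗ map suc L → x ∈ outside ∷ X
  ∈ₗ⇒∈′ x∈sucL with ∈-map⁻ suc x∈sucL
  ... | _ , y∈L , refl = there (∈ₗ⇒∈ y∈L)

module _ {A : Set} {P Q₁ Q₂ Q₃ : A → Set} where

  private
    Qs : A → Set
    Qs x = Q₁ x × Q₂ x × Q₃ x

    SomeQ : A → Set
    SomeQ x = Q₁ x ⊎ Q₂ x ⊎ Q₃ x

    OneQ : List A → Set
    OneQ L = All Q₁ L ⊎ All Q₂ L ⊎ All Q₃ L

    all-some : ∀ {x y} → Qs x → SomeQ y → OneQ (x ∷ y ∷ [])
    all-some (q₁ , q₂ , q₃) =
      Data.Sum.map (λ q → q₁ ∷ q ∷ []) (Data.Sum.map (λ q → q₂ ∷ q ∷ []) (λ q → q₃ ∷ q ∷ []))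

    some-all : ∀ {x y} → SomeQ x → Qs y → OneQ (x ∷ y ∷ [])
    some-all q (q₁ , q₂ , q₃) =
      Data.Sum.map (λ q → q ∷ q₁ ∷ []) (Data.Sum.map (λ q → q ∷ q₂ ∷ []) (λ q → q ∷ q₃ ∷ [])) q

  common-choice : ∀ L → length L ≤ 2 → All (λ x → P x ⊎ Qs x) L → All SomeQ L →
                  All P L ⊎ OneQ L
  common-choice [] _ _ _ = inj₁ []
  common-choice (_ ∷ []) _ (inj₁ p ∷ []) _ = inj₁ (p ∷ [])
  common-choice (_ ∷ []) _ (inj₂ (q₁ , _) ∷ []) _ = inj₂ (inj₁ (q₁ ∷ []))
  common-choice (_ ∷ _ ∷ []) _ (inj₁ px ∷ inj₁ py ∷ []) _ = inj₁ (px ∷ py ∷ [])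
  common-choice (_ ∷ _ ∷ []) _ (inj₂ qx ∷ _ ∷ []) (_ ∷ qy ∷ []) = inj₂ (all-some qx qy)
  common-choice (_ ∷ _ ∷ []) _ (inj₁ _ ∷ inj₂ qy ∷ []) (qx ∷ _ ∷ []) = inj₂ (some-all qx qy)
  common-choice (_ ∷ _ ∷ _ ∷ _) (s≤s (s≤s ())) _ _

subset-common-choice : ∀ {m} {P Q₁ Q₂ Q₃ : Fin m → Set} (X : Subset m) → ∣ X ∣ ≤ 2 →
  (∀ {x} → x ∈ X → P x ⊎ Q₁ x × Q₂ x × Q₃ x) →
  (∀ {x} → x ∈ X → Q₁ x ⊎ Q₂ x ⊎ Q₃ x) →
  (∀ {x} → x ∈ X → P x) ⊎ (∀ {x} → x ∈ X → Q₁ x) ⊎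
  (∀ {x} → x ∈ X → Q₂ x) ⊎ (∀ {x} → x ∈ X → Q₃ x)
subset-common-choice {P = P} {Q₁} {Q₂} {Q₃} X ∣X∣≤2 dichotomy some with members X
... | L , length≡ , ∈⇒∈ₗ , ∈ₗ⇒∈ = Data.Sum.map onX (Data.Sum.map onX (Data.Sum.map onX onX))
  (common-choice {P = P} {Q₁} {Q₂} {Q₃} L (subst (_≤ 2) (sym length≡) ∣X∣≤2)
    (All.tabulate (dichotomy ∘ ∈ₗ⇒∈)) (All.tabulate (some ∘ ∈ₗ⇒∈)))
  where
  onX : ∀ {R : Fin _ → Set} → All R L → ∀ {x} → x ∈ X → R x
  onX all = All.lookup all ∘ ∈⇒∈ₗ

module Congruence (n : ℕ) where

  infix 4 _≋_
  _≋_ : ℕ → ℕ → Set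
  x ≋ y = ∃₂ λ i j → x + i * n ≡ y + j * n

  ≋-reflexive : ∀ {x y} → x ≡ y → x ≋ y
  ≋-reflexive refl = 0 , 0 , refl

  ≋-sym : ∀ {x y} → x ≋ y → y ≋ x
  ≋-sym (i , j , e) = j , i , sym e

  ≋-trans : ∀ {x y z} → x ≋ y → y ≋ z → x ≋ z
  ≋-trans {x} {y} {z} (i , j , e) (i′ , j′ , e′) = i + i′ , j′ + j , (begin
    x + (i + i′) * n      ≡⟨ regroup x i i′ n ⟩
    (x + i * n) + i′ * n  ≡⟨ cong (_+ i′ * n) e ⟩
    (y + j * n) + i′ * n  ≡⟨ xy∙z≈xz∙y y (j * n) (i′ * n) ⟩
    (y + i′ * n) + j * n  ≡⟨ cong (_+ j * n) e′ ⟩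
    (z + j′ * n) + j * n  ≡⟨ sym (regroup z j′ j n) ⟩
    z + (j′ + j) * n      ∎)
    where
    open ≡-Reasoning
    regroup : ∀ x i i′ n → x + (i + i′) * n ≡ (x + i * n) + i′ * n
    regroup = solve-∀

  n≋0 : n ≋ 0
  n≋0 = 0 , 1 , refl

  %-≋ : .{{_ : NonZero n}} → ∀ x → x % n ≋ x
  %-≋ x = x / n , 0 , trans (sym (m≡m%n+[m/n]*n x n)) (sym (+-identityʳ x))

  +-congʳ-≋ : ∀ {x y} z → x ≋ y → x + z ≋ y + z
  +-congʳ-≋ {x} {y} z (i , j , e) = i , j , (begin
    x + z + i * n  ≡⟨ xy∙z≈xz∙y x z (i * n) ⟩
    x + i * n + z  ≡⟨ cong (_+ z) e ⟩
    y + j * n + z  ≡⟨ xy∙z≈xz∙y y (j * n) z ⟩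
    y + z + j * n  ∎)
    where open ≡-Reasoning

  +-congˡ-≋ : ∀ {x y} z → x ≋ y → z + x ≋ z + y
  +-congˡ-≋ {x} {y} z c = subst₂ _≋_ (+-comm x z) (+-comm y z) (+-congʳ-≋ z c)

  +n≋ : ∀ x → x + n ≋ x
  +n≋ x = ≋-trans (+-congˡ-≋ x n≋0) (≋-reflexive (+-identityʳ x))

  +[n∸s]+s≋ : ∀ x {s} → s ≤ n → x + (n ∸ s) + s ≋ x
  +[n∸s]+s≋ x {s} s≤n =
    ≋-trans (≋-reflexive (trans (+-assoc x (n ∸ s) s) (cong (_+_ x) (m∸n+n≡m s≤n)))) (+n≋ x)

  +-cancelʳ-≋ : ∀ {x y} z → x + z ≋ y + z → x ≋ y
  +-cancelʳ-≋ {x} {y} z (i , j , e) = i , j , +-cancelʳ-≡ z _ _ (begin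
    x + i * n + z  ≡⟨ xy∙z≈xz∙y x (i * n) z ⟩
    x + z + i * n  ≡⟨ e ⟩
    y + z + j * n  ≡⟨ xy∙z≈xz∙y y z (j * n) ⟩
    y + j * n + z  ∎)
    where open ≡-Reasoning

  +-cancelˡ-≋ : ∀ {x y} z → z + x ≋ z + y → x ≋ y
  +-cancelˡ-≋ {x} {y} z c = +-cancelʳ-≋ z (subst₂ _≋_ (+-comm z x) (+-comm z y) c)

  ≋-lift : ∀ {x y} → x ≋ y → x < n + n → y < n → x ≡ y ⊎ x ≡ y + n
  ≋-lift {x} {y} (i , j , e) = lift i j e
    where
    lift : ∀ i j → x + i * n ≡ y + j * n → x < n + n → y < n → x ≡ y ⊎ x ≡ y + n
    lift zero zero e _ _ = inj₁ (+-cancelʳ-≡ 0 x y e)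
    lift zero (suc zero) e _ _ =
      inj₂ (trans (sym (+-identityʳ x)) (trans e (cong (_+_ y) (+-identityʳ n))))
    lift zero (suc (suc j)) e x<2n _ = ⊥-elim (<⇒≱ x<2n (begin
      n + n                    ≤⟨ m≤n+m (n + n) (y + j * n) ⟩
      y + j * n + (n + n)      ≡⟨ regroup y j n ⟩
      y + suc (suc j) * n      ≡⟨ sym e ⟩
      x + 0                    ≡⟨ +-identityʳ x ⟩
      x                        ∎))
      where
      open ≤-Reasoning
      regroup : ∀ y j n → y + j * n + (n + n) ≡ y + (n + (n + j * n))
      regroup = solve-∀
    lift (suc i) zero e _ y<n = ⊥-elim (<⇒≱ y<n (begin
      n                        ≤⟨ m≤n+m n (x + i * n) ⟩
      x + i * n + n            ≡⟨ regroup x i n ⟩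
      x + suc i * n            ≡⟨ e ⟩
      y + 0                    ≡⟨ +-identityʳ y ⟩
      y                        ∎))
      where
      open ≤-Reasoning
      regroup : ∀ x i n → x + i * n + n ≡ x + (n + i * n)
      regroup = solve-∀
    lift (suc i) (suc j) e = lift i j (+-cancelʳ-≡ n _ _ (begin
      x + i * n + n  ≡⟨ regroup x i n ⟩
      x + suc i * n  ≡⟨ e ⟩
      y + suc j * n  ≡⟨ sym (regroup y j n) ⟩
      y + j * n + n  ∎))
      where
      open ≡-Reasoning
      regroup : ∀ x i n → x + i * n + n ≡ x + (n + i * n)
      regroup = solve-∀

  ≋⇒≡ : ∀ {x y} → x ≋ y → x < n → y < n → x ≡ y
  ≋⇒≡ {x} {y} c x<n y<n with ≋-lift c (≤-trans x<n (m≤m+n n n)) y<n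
  ... | inj₁ x≡y   = x≡y
  ... | inj₂ x≡y+n = ⊥-elim (<⇒≱ x<n (subst (n ≤_) (sym x≡y+n) (m≤n+m n y)))

data Orientation : Set where
  forward backward : Orientation

sign : Orientation → ℤ
sign forward  = ℤ.1ℤ
sign backward = ℤ.-1ℤ

module Cycle (n : ℕ) .{{_ : NonZero n}} where

  open Congruence n

  diff<n : ∀ u v → diff n u v < n
  diff<n u v = m%n<n _ n

  +-diff : ∀ u v → toℕ u + diff n u v ≋ toℕ v
  +-diff u v = ≋-trans (+-congˡ-≋ (toℕ u) (%-≋ _)) (≋-trans (≋-reflexive rearrange)
    (≋-trans (+-congˡ-≋ (toℕ v) n≋0) (≋-reflexive (+-identityʳ (toℕ v)))))
    where
    rearrange : toℕ u + (toℕ v + (n ∸ toℕ u)) ≡ toℕ v + n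
    rearrange = begin
      toℕ u + (toℕ v + (n ∸ toℕ u))  ≡⟨ x∙yz≈y∙xz (toℕ u) (toℕ v) (n ∸ toℕ u) ⟩
      toℕ v + (toℕ u + (n ∸ toℕ u))  ≡⟨ cong (_+_ (toℕ v)) (m+[n∸m]≡n (<⇒≤ (toℕ<n u))) ⟩
      toℕ v + n                      ∎
      where open ≡-Reasoning

  toℕ-≋-injective : ∀ {u v : Fin n} → toℕ u ≋ toℕ v → u ≡ v
  toℕ-≋-injective {u} {v} c = toℕ-injective (≋⇒≡ c (toℕ<n u) (toℕ<n v))

  diff-unique : ∀ u v {d} → d < n → toℕ u + d ≋ toℕ v → d ≡ diff n u v
  diff-unique u v d<n c =
    ≋⇒≡ (+-cancelˡ-≋ (toℕ u) (≋-trans c (≋-sym (+-diff u v)))) d<n (diff<n u v)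

  diff-self : ∀ u → diff n u u ≡ 0
  diff-self u = sym (diff-unique u u (≤-<-trans z≤n (toℕ<n u)) (≋-reflexive (+-identityʳ (toℕ u))))

  diff≡0⇒≡ : ∀ {u v} → diff n u v ≡ 0 → u ≡ v
  diff≡0⇒≡ {u} {v} d≡0 = toℕ-≋-injective (≋-trans
    (≋-reflexive (sym (trans (cong (_+_ (toℕ u)) d≡0) (+-identityʳ (toℕ u))))) (+-diff u v))

  diff-+ : ∀ u w v → diff n u w + diff n w v ≋ diff n u v
  diff-+ u w v = +-cancelˡ-≋ (toℕ u) (≋-trans (≋-reflexive (sym (+-assoc (toℕ u) _ _)))
    (≋-trans (+-congʳ-≋ (diff n w v) (+-diff u w)) (≋-trans (+-diff w v) (≋-sym (+-diff u v)))))

  infixl 6 _⊕_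
  _⊕_ : Fin n → ℕ → Fin n
  u ⊕ e = (toℕ u + e) mod n

  toℕ-mod : ∀ x → toℕ (x mod n) ≋ x
  toℕ-mod x = subst (_≋ x) (sym (toℕ-fromℕ< (m%n<n x n))) (%-≋ x)

  toℕ-⊕ : ∀ u e → toℕ (u ⊕ e) ≋ toℕ u + e
  toℕ-⊕ u e = toℕ-mod (toℕ u + e)

  diff-⊕ : ∀ u {e} → e < n → diff n u (u ⊕ e) ≡ e
  diff-⊕ u e<n = sym (diff-unique u (u ⊕ _) e<n (≋-sym (toℕ-⊕ u _)))

  -- d ≤ᶜ K: the residue d lies within K of 0 around the cycle, i.e. min d (n ∸ d) ≤ K.
  infix 4 _≤ᶜ_
  _≤ᶜ_ : ℕ → ℕ → Set
  d ≤ᶜ K = d ≤ K ⊎ n ≤ d + K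

  infix 4 _≤ᶜ?_
  _≤ᶜ?_ : ∀ d K → Dec (d ≤ᶜ K)
  d ≤ᶜ? K = d ≤? K ⊎-dec n ≤? d + K

  ≤ᶜ-refl : ∀ {d} → d ≤ᶜ d
  ≤ᶜ-refl = inj₁ ≤-refl

  ≤ᶜ-mono : ∀ {d K K′} → K ≤ K′ → d ≤ᶜ K → d ≤ᶜ K′
  ≤ᶜ-mono K≤K′ (inj₁ d≤K)   = inj₁ (≤-trans d≤K K≤K′)
  ≤ᶜ-mono K≤K′ (inj₂ n≤d+K) = inj₂ (≤-trans n≤d+K (+-monoʳ-≤ _ K≤K′))

  private
    ≤ᶜ-triangle-near : ∀ {α β γ K L} → β < n → α + β ≡ γ ⊎ α + β ≡ γ + n →
                       α ≤ K → β ≤ᶜ L → γ ≤ᶜ K + L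
    ≤ᶜ-triangle-near {K = K} {L} _ (inj₁ e) α≤K (inj₁ β≤L) =
      inj₁ (subst (_≤ K + L) e (+-mono-≤ α≤K β≤L))
    ≤ᶜ-triangle-near {γ = γ} {K} {L} _ (inj₂ e) α≤K (inj₁ β≤L) =
      inj₁ (≤-trans (m≤m+n γ n) (subst (_≤ K + L) e (+-mono-≤ α≤K β≤L)))
    ≤ᶜ-triangle-near {α} {β} {K = K} {L} _ (inj₁ e) _ (inj₂ n≤β+L) =
      inj₂ (≤-trans n≤β+L (+-mono-≤ (subst (β ≤_) e (m≤n+m β α)) (m≤n+m L K)))
    ≤ᶜ-triangle-near {α} {β} {γ} {K} {L} β<n (inj₂ e) α≤K (inj₂ _) =
      inj₁ (≤-trans (<⇒≤ γ<K) (m≤m+n K L))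
      where
      open ≤-Reasoning
      γ<K : γ < K
      γ<K = +-cancelʳ-< n γ K (begin-strict
        γ + n  ≡⟨ sym e ⟩
        α + β  ≤⟨ +-monoˡ-≤ β α≤K ⟩
        K + β  <⟨ +-monoʳ-< K β<n ⟩
        K + n  ∎)

    ≤ᶜ-triangle-far : ∀ {α β γ K L} → α + β ≡ γ ⊎ α + β ≡ γ + n →
                      n ≤ α + K → n ≤ β + L → γ ≤ᶜ K + L
    ≤ᶜ-triangle-far {α} {β} {γ} {K} {L} (inj₁ e) n≤α+K _ =
      inj₂ (≤-trans n≤α+K (+-mono-≤ (subst (α ≤_) e (m≤m+n α β)) (m≤m+n K L)))
    ≤ᶜ-triangle-far {α} {β} {γ} {K} {L} (inj₂ e) n≤α+K n≤β+L =
      inj₂ (+-cancelʳ-≤ n n (γ + (K + L)) (begin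
      n + n                ≤⟨ +-mono-≤ n≤α+K n≤β+L ⟩
      (α + K) + (β + L)    ≡⟨ interchange α K β L ⟩
      (α + β) + (K + L)    ≡⟨ cong (_+ (K + L)) e ⟩
      γ + n + (K + L)      ≡⟨ xy∙z≈xz∙y γ n (K + L) ⟩
      γ + (K + L) + n      ∎))
      where open ≤-Reasoning

  ≤ᶜ-triangle : ∀ {α β γ K L} → α < n → β < n → γ < n → α + β ≋ γ →
                α ≤ᶜ K → β ≤ᶜ L → γ ≤ᶜ K + L
  ≤ᶜ-triangle {α} {β} {γ} {K} {L} α<n β<n γ<n c α≤ᶜK β≤ᶜL
    with ≋-lift c (+-mono-< α<n β<n) γ<n | α≤ᶜK | β≤ᶜL
  ... | e | inj₁ α≤K   | _          = ≤ᶜ-triangle-near β<n e α≤K β≤ᶜL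
  ... | e | inj₂ n≤α+K | inj₁ β≤L   = subst (γ ≤ᶜ_) (+-comm L K)
    (≤ᶜ-triangle-near α<n (Data.Sum.map (trans (+-comm β α)) (trans (+-comm β α)) e) β≤L (inj₂ n≤α+K))
  ... | e | inj₂ n≤α+K | inj₂ n≤β+L = ≤ᶜ-triangle-far {α} {β} {γ} {K} {L} e n≤α+K n≤β+L

  ≤ᶜ-neg : ∀ {α β K} → α < n → β < n → α + β ≋ 0 → α ≤ᶜ K → β ≤ᶜ K
  ≤ᶜ-neg {α} {β} {K} α<n β<n c α≤ᶜK
    with ≋-lift c (+-mono-< α<n β<n) (≤-<-trans z≤n α<n) | α≤ᶜK
  ... | inj₁ α+β≡0 | _ = inj₁ (subst (_≤ K) (sym (m+n≡0⇒n≡0 α α+β≡0)) z≤n)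
  ... | inj₂ α+β≡n | inj₁ α≤K   = inj₂ (≤-trans (≤-reflexive (sym α+β≡n))
                                      (≤-trans (+-monoˡ-≤ β α≤K) (≤-reflexive (+-comm K β))))
  ... | inj₂ α+β≡n | inj₂ n≤α+K = inj₁ (+-cancelˡ-≤ α β K (≤-trans (≤-reflexive α+β≡n) n≤α+K))

  adj⇒≤ᶜ4 : ∀ {u w} → Adj n u w → diff n u w ≤ᶜ 4
  adj⇒≤ᶜ4 (_ , s , (_ , s≤4) , inj₁ d≡s) = inj₁ (subst (_≤ 4) (sym d≡s) s≤4)
  adj⇒≤ᶜ4 {u} {w} (_ , s , (1≤s , s≤4) , inj₂ d≡[n∸s]%n) with s <? n
  ... | yes s<n = inj₂ (begin
    n                ≡⟨ sym (m∸n+n≡m (<⇒≤ s<n)) ⟩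
    (n ∸ s) + s      ≤⟨ +-monoʳ-≤ (n ∸ s) s≤4 ⟩
    (n ∸ s) + 4      ≡⟨ cong (_+ 4) (sym d≡n∸s) ⟩
    diff n u w + 4   ∎)
    where
    open ≤-Reasoning
    d≡n∸s : diff n u w ≡ n ∸ s
    d≡n∸s = trans d≡[n∸s]%n (m<n⇒m%n≡m (∸-monoʳ-< {n} {s} {0} 1≤s (<⇒≤ s<n)))
  ... | no s≮n = inj₁ (≤-trans (<⇒≤ (diff<n u w)) (≤-trans (≮⇒≥ s≮n) s≤4))

  reach⇒≤ᶜ : ∀ m {u v} → Reach n m u v → diff n u v ≤ᶜ 4 * m
  reach⇒≤ᶜ zero {u} refl = inj₁ (≤-reflexive (diff-self u))
  reach⇒≤ᶜ (suc m) (inj₁ r) = ≤ᶜ-mono (*-monoʳ-≤ 4 (n≤1+n m)) (reach⇒≤ᶜ m r)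
  reach⇒≤ᶜ (suc m) {u} {v} (inj₂ (w , u~w , r)) = subst (diff n u v ≤ᶜ_) (sym (*-suc 4 m))
    (≤ᶜ-triangle (diff<n u w) (diff<n w v) (diff<n u v) (diff-+ u w v)
                 (adj⇒≤ᶜ4 u~w) (reach⇒≤ᶜ m r))

  adjacent : ∀ {u w s} → 1 ≤ s → s ≤ 4 → s < n → diff n u w ≡ s → Adj n u w × Adj n w u
  adjacent {u} {w} {s} 1≤s s≤4 s<n d≡s =
    (u≢w , s , (1≤s , s≤4) , inj₁ d≡s) , (u≢w ∘ sym , s , (1≤s , s≤4) , inj₂ back)
    where
    u≢w : u ≢ w
    u≢w refl = <⇒≢ 1≤s (trans (sym (diff-self u)) d≡s)
    n∸s<n : n ∸ s < n
    n∸s<n = ∸-monoʳ-< {n} {s} {0} 1≤s (<⇒≤ s<n)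
    w+[n∸s]≋u : toℕ w + (n ∸ s) ≋ toℕ u
    w+[n∸s]≋u = ≋-trans
      (+-congʳ-≋ (n ∸ s) (≋-sym (subst (λ d → toℕ u + d ≋ toℕ w) d≡s (+-diff u w))))
      (≋-trans (≋-reflexive (xy∙z≈xz∙y (toℕ u) s (n ∸ s))) (+[n∸s]+s≋ (toℕ u) (<⇒≤ s<n)))
    back : diff n w u ≡ (n ∸ s) % n
    back = trans (sym (diff-unique w u n∸s<n w+[n∸s]≋u)) (sym (m<n⇒m%n≡m n∸s<n))

  step-forward : ∀ {K u v} → K < diff n u v → diff n u v ≤ 4 + K →
                 ∃ λ w → Adj n u w × diff n w v ≡ K
  step-forward {K} {u} {v} K<d d≤4+K = u ⊕ s , u~u⊕s , d[u⊕s,v]≡K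
    where
    d = diff n u v
    s = d ∸ K
    s<n : s < n
    s<n = ≤-<-trans (m∸n≤m d K) (diff<n u v)
    s≤4 : s ≤ 4
    s≤4 = m≤n+o⇒m∸n≤o d K (subst (d ≤_) (+-comm 4 K) d≤4+K)
    u~u⊕s : Adj n u (u ⊕ s)
    u~u⊕s = proj₁ (adjacent (m<n⇒0<n∸m K<d) s≤4 s<n (diff-⊕ u s<n))
    s+d[u⊕s,v]≋s+K : s + diff n (u ⊕ s) v ≋ s + K
    s+d[u⊕s,v]≋s+K = ≋-trans (subst (λ e → e + diff n (u ⊕ s) v ≋ d) (diff-⊕ u s<n) (diff-+ u (u ⊕ s) v))
                             (≋-reflexive (sym (m∸n+n≡m (<⇒≤ K<d))))
    d[u⊕s,v]≡K : diff n (u ⊕ s) v ≡ K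
    d[u⊕s,v]≡K = ≋⇒≡ (+-cancelˡ-≋ s s+d[u⊕s,v]≋s+K) (diff<n (u ⊕ s) v) (<-trans K<d (diff<n u v))

  step-backward : ∀ {K u v} → K < diff n u v → diff n u v + K < n → n ≤ diff n u v + (4 + K) →
                  ∃ λ w → Adj n u w × K + diff n w v ≋ 0
  step-backward {K} {u} {v} K<d d+K<n n≤d+4+K =
    w , proj₂ (adjacent 1≤s s≤4 s<n d[w,u]≡s) , K+d[w,v]≋0
    where
    d = diff n u v
    s = n ∸ (d + K)
    1≤s : 1 ≤ s
    1≤s = m<n⇒0<n∸m d+K<n
    s≤4 : s ≤ 4
    s≤4 = m≤n+o⇒m∸n≤o n (d + K) (subst (n ≤_) (x∙yz≈xz∙y d 4 K) n≤d+4+K)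
    s<n : s < n
    s<n = ∸-monoʳ-< {n} {d + K} {0} (≤-trans (s≤s z≤n) (≤-trans K<d (m≤m+n d K))) (<⇒≤ d+K<n)
    w = u ⊕ (n ∸ s)
    d[w,u]≡s : diff n w u ≡ s
    d[w,u]≡s = sym (diff-unique w u s<n
      (≋-trans (+-congʳ-≋ s (toℕ-⊕ u (n ∸ s))) (+[n∸s]+s≋ (toℕ u) (<⇒≤ s<n))))
    K+d[w,v]≋0 : K + diff n w v ≋ 0
    K+d[w,v]≋0 = ≋-trans
      (+-congˡ-≋ K (≋-sym (subst (λ e → e + d ≋ diff n w v) d[w,u]≡s (diff-+ w u v))))
      (≋-trans (≋-reflexive (trans (regroup K s d) (m∸n+n≡m (<⇒≤ d+K<n)))) n≋0)
      where
      regroup : ∀ K s d → K + (s + d) ≡ s + (d + K)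
      regroup = solve-∀

  step-toward : ∀ K {u v} → ¬ diff n u v ≤ᶜ K → diff n u v ≤ᶜ 4 + K →
                ∃ λ w → Adj n u w × diff n w v ≤ᶜ K
  step-toward K {u} {v} d≰ᶜK (inj₁ d≤4+K) =
    let w , u~w , d[w,v]≡K = step-forward K<d d≤4+K in w , u~w , inj₁ (≤-reflexive d[w,v]≡K)
    where
    K<d : K < diff n u v
    K<d = ≰⇒> (d≰ᶜK ∘ inj₁)
  step-toward K {u} {v} d≰ᶜK (inj₂ n≤d+4+K) =
    let w , u~w , K+d[w,v]≋0 = step-backward K<d (≰⇒> (d≰ᶜK ∘ inj₂)) n≤d+4+K
    in  w , u~w , ≤ᶜ-neg (<-trans K<d (diff<n u v)) (diff<n w v) K+d[w,v]≋0 ≤ᶜ-refl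
    where
    K<d : K < diff n u v
    K<d = ≰⇒> (d≰ᶜK ∘ inj₁)

  ≤ᶜ⇒reach : ∀ m {u v} → diff n u v ≤ᶜ 4 * m → Reach n m u v
  ≤ᶜ⇒reach zero (inj₁ d≤0) = diff≡0⇒≡ (n≤0⇒n≡0 d≤0)
  ≤ᶜ⇒reach zero {u} {v} (inj₂ n≤d+0) =
    ⊥-elim (<⇒≱ (diff<n u v) (subst (n ≤_) (+-identityʳ _) n≤d+0))
  ≤ᶜ⇒reach (suc m) {u} {v} d≤ᶜ4+4m with diff n u v ≤ᶜ? 4 * m
  ... | yes d≤ᶜ4m = inj₁ (≤ᶜ⇒reach m d≤ᶜ4m)
  ... | no d≰ᶜ4m =
    let w , u~w , d[w,v]≤ᶜ4m =
          step-toward (4 * m) d≰ᶜ4m (subst (diff n u v ≤ᶜ_) (*-suc 4 m) d≤ᶜ4+4m)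
    in  inj₂ (w , u~w , ≤ᶜ⇒reach m d[w,v]≤ᶜ4m)

  reach⇔≤ᶜ : ∀ m {u v} → Reach n m u v ⇔ diff n u v ≤ᶜ 4 * m
  reach⇔≤ᶜ m = mk⇔ (reach⇒≤ᶜ m) (≤ᶜ⇒reach m)

  reach-mono : ∀ {m m′ u v} → m ≤ m′ → Reach n m u v → Reach n m′ u v
  reach-mono {m} {m′} m≤m′ = ≤ᶜ⇒reach m′ ∘ ≤ᶜ-mono (*-monoʳ-≤ 4 m≤m′) ∘ reach⇒≤ᶜ m

  reach? : ∀ m u v → Dec (Reach n m u v)
  reach? m u v = Dec.map (⇔-sym (reach⇔≤ᶜ m)) (diff n u v ≤ᶜ? 4 * m)

  distance : ∀ u v → ∃ (IsDist n u v)
  distance u v = least n (≤ᶜ⇒reach n (inj₁ (≤-trans (<⇒≤ (diff<n u v)) (m≤n*m n 4))))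
    where
    least : ∀ M → Reach n M u v → ∃ (IsDist n u v)
    least zero r = 0 , r , λ _ ()
    least (suc M) r with reach? M u v
    ... | yes r′ = least M r′
    ... | no ¬r′ = suc M , r , λ m m<1+M r″ → ¬r′ (reach-mono (≤-pred m<1+M) r″)

  isDist⇒reach⇔ : ∀ {u v d} → IsDist n u v d → ∀ m → Reach n m u v ⇔ d ≤ m
  isDist⇒reach⇔ (r , minimal) m =
    mk⇔ (λ r′ → ≮⇒≥ (λ m<d → minimal m m<d r′)) (λ d≤m → reach-mono d≤m r)

  Equidistant : Fin n → Fin n → Fin n → Set
  Equidistant x v w = ∀ m → Reach n m v x ⇔ Reach n m w x

  isDist⇒equidistant : ∀ {x v w d} → IsDist n v x d → IsDist n w x d → Equidistant x v w
  isDist⇒equidistant dv dw m = mk⇔ (from (isDist⇒reach⇔ dw m) ∘ to (isDist⇒reach⇔ dv m))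
                                   (from (isDist⇒reach⇔ dv m) ∘ to (isDist⇒reach⇔ dw m))

  equidistant⇒sameRep : ∀ {X v w} → (∀ x → x ∈ X → Equidistant x v w) → SameRep n X v w
  equidistant⇒sameRep same x x∈X m = transfer (same x x∈X) , transfer (λ m′ → ⇔-sym (same x x∈X m′))
    where
    transfer : ∀ {v w} → Equidistant x v w → IsDist n v x m → IsDist n w x m
    transfer vw (r , minimal) = to (vw m) r , λ m′ m′<m r′ → minimal m′ m′<m (from (vw m′) r′)

  adj⇒dist≤1+dist : ∀ {u w x d d′} → Adj n u w → IsDist n u x d → IsDist n w x d′ → d ≤ suc d′
  adj⇒dist≤1+dist {d′ = d′} u~w du (r , _) = to (isDist⇒reach⇔ du (suc d′)) (inj₂ (_ , u~w , r))

  triangle-equidistant : ∀ {u₁ u₂ u₃} x → Adj n u₁ u₂ × Adj n u₂ u₁ → Adj n u₂ u₃ × Adj n u₃ u₂ →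
                         Adj n u₁ u₃ × Adj n u₃ u₁ →
                         Equidistant x u₁ u₂ ⊎ Equidistant x u₂ u₃ ⊎ Equidistant x u₁ u₃
  triangle-equidistant {u₁} {u₂} {u₃} x (a₁₂ , a₂₁) (a₂₃ , a₃₂) (a₁₃ , a₃₁)
    with distance u₁ x | distance u₂ x | distance u₃ x
  ... | d₁ , D₁ | d₂ , D₂ | d₃ , D₃
    with within-one⇒two-equal (adj⇒dist≤1+dist a₁₂ D₁ D₂) (adj⇒dist≤1+dist a₂₁ D₂ D₁)
                    (adj⇒dist≤1+dist a₂₃ D₂ D₃) (adj⇒dist≤1+dist a₃₂ D₃ D₂)
                    (adj⇒dist≤1+dist a₁₃ D₁ D₃) (adj⇒dist≤1+dist a₃₁ D₃ D₁)
  ... | inj₁ refl        = inj₁ (isDist⇒equidistant D₁ D₂)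
  ... | inj₂ (inj₁ refl) = inj₂ (inj₁ (isDist⇒equidistant D₂ D₃))
  ... | inj₂ (inj₂ refl) = inj₂ (inj₂ (isDist⇒equidistant D₁ D₃))

  -[1+]%ℕ-≋ : ∀ m → -[1+ m ] %ℕ n + suc m ≋ 0
  -[1+]%ℕ-≋ m with suc m % n | m%n<n (suc m) n | m≡m%n+[m/n]*n (suc m) n
  ... | zero  | _   | e = 0 , suc m / n , trans (+-identityʳ (suc m)) e
  ... | suc r | r<n | e = 0 , suc q , trans (+-identityʳ _) (begin
    n ∸ suc r + suc m            ≡⟨ cong (_+_ (n ∸ suc r)) e ⟩
    n ∸ suc r + (suc r + q * n)  ≡⟨ sym (+-assoc (n ∸ suc r) (suc r) (q * n)) ⟩
    n ∸ suc r + suc r + q * n    ≡⟨ cong (_+ q * n) (m∸n+n≡m (<⇒≤ r<n)) ⟩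
    n + q * n                    ∎)
    where
    open ≡-Reasoning
    q = suc m / n

  toℕ-shift-+ : ∀ a s → toℕ (shift n a (+ s)) ≋ toℕ a + s
  toℕ-shift-+ a s = ≋-trans (toℕ-mod _) (%-≋ _)

  toℕ-shift-- : ∀ a s → toℕ (shift n a (- (+ s))) + s ≋ toℕ a
  toℕ-shift-- a zero =
    ≋-trans (≋-reflexive (+-identityʳ _)) (≋-trans (toℕ-shift-+ a 0) (≋-reflexive (+-identityʳ _)))
  toℕ-shift-- a (suc s) with toℕ a <? suc s
  ... | no a≮1+s = ≋-trans (+-congʳ-≋ (suc s) (≋-trans (toℕ-mod _) (≋-trans
                     (≋-reflexive (cong (_%ℕ n) (ℤₚ.⊖-≥ (≮⇒≥ a≮1+s)))) (%-≋ _))))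
                     (≋-reflexive (m∸n+n≡m (≮⇒≥ a≮1+s)))
  ... | yes a<1+s = ≋-trans (+-congʳ-≋ (suc s) (toℕ-mod _))
                      (≋-trans (≋-reflexive (cong (λ z → z %ℕ n + suc s) a⊖1+s≡))
                      (≋-trans (≋-reflexive (regroup (-[1+ s ∸ toℕ a ] %ℕ n)))
                      (+-congʳ-≋ (toℕ a) (-[1+]%ℕ-≋ (s ∸ toℕ a)))))
    where
    a≤s : toℕ a ≤ s
    a≤s = ≤-pred a<1+s
    a⊖1+s≡ : toℕ a ⊖ suc s ≡ -[1+ s ∸ toℕ a ]
    a⊖1+s≡ = trans (ℤₚ.⊖-< a<1+s) (cong (λ z → - (+ z)) (+-∸-assoc 1 a≤s))
    regroup : ∀ r → r + suc s ≡ r + suc (s ∸ toℕ a) + toℕ a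
    regroup r = trans (cong (λ z → r + suc z) (sym (m∸n+n≡m a≤s)))
                      (sym (+-assoc r (suc (s ∸ toℕ a)) (toℕ a)))

  diff-shift-+ : ∀ a {s} → s < n → diff n a (shift n a (+ s)) ≡ s
  diff-shift-+ a {s} s<n = sym (diff-unique a _ s<n (≋-sym (toℕ-shift-+ a s)))

  diff-shift-- : ∀ a {s} → s < n → diff n (shift n a (- (+ s))) a ≡ s
  diff-shift-- a {s} s<n = sym (diff-unique _ a s<n (toℕ-shift-- a s))

  δ : Orientation → Fin n → Fin n → ℕ
  δ forward  u v = diff n u v
  δ backward u v = diff n v u

  δ<n : ∀ σ u v → δ σ u v < n
  δ<n forward  u v = diff<n u v
  δ<n backward u v = diff<n v u

  δ-+ : ∀ σ u w v → δ σ u w + δ σ w v ≋ δ σ u v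
  δ-+ forward  u w v = diff-+ u w v
  δ-+ backward u w v = subst (_≋ diff n v u) (+-comm (diff n v w) (diff n w u)) (diff-+ v w u)

  δ≡0⇒≡ : ∀ σ {u v} → δ σ u v ≡ 0 → u ≡ v
  δ≡0⇒≡ forward  = diff≡0⇒≡
  δ≡0⇒≡ backward = sym ∘ diff≡0⇒≡

  δ-self : ∀ σ u → δ σ u u ≡ 0
  δ-self forward  = diff-self
  δ-self backward = diff-self

  δ-+-inverse : ∀ σ u v → δ σ u v + δ σ v u ≋ 0
  δ-+-inverse σ u v = ≋-trans (δ-+ σ u v u) (≋-reflexive (δ-self σ u))

  δ-between : ∀ σ {a v w s d} → δ σ a v ≡ s → δ σ a w ≡ s + d → d < n → δ σ v w ≡ d
  δ-between σ {a} {v} {w} {s} refl a→w≡s+d d<n =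
    ≋⇒≡ (+-cancelˡ-≋ s (≋-trans (δ-+ σ a v w) (≋-reflexive a→w≡s+d))) (δ<n σ v w) d<n

  δ-injectiveˡ : ∀ σ {u v a} → δ σ u a ≡ δ σ v a → u ≡ v
  δ-injectiveˡ σ {u} {v} {a} eq = δ≡0⇒≡ σ
    (≋⇒≡ (+-cancelʳ-≋ (δ σ v a) (≋-trans (δ-+ σ u v a) (≋-reflexive eq)))
         (δ<n σ u v) (≤-<-trans z≤n (δ<n σ u v)))

  reach⇔δ≤ᶜ : ∀ σ m {u v} → Reach n m u v ⇔ δ σ u v ≤ᶜ 4 * m
  reach⇔δ≤ᶜ forward  m = reach⇔≤ᶜ m
  reach⇔δ≤ᶜ backward m {u} {v} = mk⇔
    (≤ᶜ-neg (diff<n u v) (diff<n v u) (δ-+-inverse forward u v) ∘ reach⇒≤ᶜ m)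
    (≤ᶜ⇒reach m ∘ ≤ᶜ-neg (diff<n v u) (diff<n u v) (δ-+-inverse forward v u))

  δ-adjacent : ∀ σ {u w s} → 1 ≤ s → s ≤ 4 → s < n → δ σ u w ≡ s → Adj n u w × Adj n w u
  δ-adjacent forward  1≤s s≤4 s<n d≡s = adjacent 1≤s s≤4 s<n d≡s
  δ-adjacent backward 1≤s s≤4 s<n d≡s = swap (adjacent 1≤s s≤4 s<n d≡s)

  δ-shift : ∀ σ a {s} → s < n → δ σ a (shift n a (sign σ ℤ.* + s)) ≡ s
  δ-shift forward  a {s} s<n =
    subst (λ z → diff n a (shift n a z) ≡ s) (sym (ℤₚ.*-identityˡ (+ s))) (diff-shift-+ a s<n)
  δ-shift backward a {s} s<n =
    subst (λ z → diff n (shift n a z) a ≡ s) (sym (ℤₚ.-1*i≡-i (+ s))) (diff-shift-- a s<n)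

  δ-shift-neg : ∀ σ a {s} → s < n → δ σ (shift n a (- (sign σ ℤ.* + s))) a ≡ s
  δ-shift-neg forward  a {s} s<n =
    subst (λ z → diff n (shift n a (- z)) a ≡ s) (sym (ℤₚ.*-identityˡ (+ s))) (diff-shift-- a s<n)
  δ-shift-neg backward a {s} s<n =
    subst (λ z → diff n a (shift n a z) ≡ s)
      (sym (trans (cong -_ (ℤₚ.-1*i≡-i (+ s))) (ℤₚ.neg-involutive (+ s)))) (diff-shift-+ a s<n)

  SameLevel : ℕ → ℕ → Set
  SameLevel γ γ′ = ∀ m → γ ≤ᶜ 4 * m ⇔ γ′ ≤ᶜ 4 * m

  sameLevel-trans : ∀ {α β γ} → SameLevel α β → SameLevel β γ → SameLevel α γ
  sameLevel-trans αβ βγ m = mk⇔ (to (βγ m) ∘ to (αβ m)) (from (αβ m) ∘ from (βγ m))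

  sameLevel⇒equidistant : ∀ σ {x v w} → SameLevel (δ σ v x) (δ σ w x) → Equidistant x v w
  sameLevel⇒equidistant σ same m = mk⇔
    (from (reach⇔δ≤ᶜ σ m) ∘ to (same m) ∘ to (reach⇔δ≤ᶜ σ m))
    (from (reach⇔δ≤ᶜ σ m) ∘ from (same m) ∘ to (reach⇔δ≤ᶜ σ m))

module Offsets (n : ℕ) .{{_ : NonZero n}} (k ℓ : ℕ)
               (8k+7≤n : 8 * k + 7 ≤ n) (n≤8k+8 : n ≤ 8 * k + 8) (ℓ≤k : ℓ ≤ k) where

  open Congruence n
  open Cycle n

  -- As n ∈ {8k+7, 8k+8}, an arc of length at most W is never shortened, at the
  -- granularity of multiples of 4, by going round the other way (W≤4m⊎W+4m<n).
  W : ℕ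
  W = 4 * k + 4

  W<n : W < n
  W<n = ≤-trans (m≤m+n (suc W) (4 * k + 2)) (≤-trans (≤-reflexive (regroup k)) 8k+7≤n)
    where
    regroup : ∀ k → suc (4 * k + 4) + (4 * k + 2) ≡ 8 * k + 7
    regroup = solve-∀

  W≡4*[1+k] : W ≡ 4 * suc k
  W≡4*[1+k] = trans (+-comm (4 * k) 4) (sym (*-suc 4 k))

  W≤4m⊎W+4m<n : ∀ m → W ≤ 4 * m ⊎ W + 4 * m < n
  W≤4m⊎W+4m<n m with m ≤? k
  ... | yes m≤k = inj₂ (begin-strict
    W + 4 * m      ≤⟨ +-monoʳ-≤ W (*-monoʳ-≤ 4 m≤k) ⟩
    W + 4 * k      <⟨ m<m+n (W + 4 * k) {3} (s≤s z≤n) ⟩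
    W + 4 * k + 3  ≡⟨ regroup k ⟩
    8 * k + 7      ≤⟨ 8k+7≤n ⟩
    n              ∎)
    where
    open ≤-Reasoning
    regroup : ∀ k → 4 * k + 4 + 4 * k + 3 ≡ 8 * k + 7
    regroup = solve-∀
  ... | no m≰k = inj₁ (subst (_≤ 4 * m) (sym W≡4*[1+k]) (*-monoʳ-≤ 4 (≰⇒> m≰k)))

  data Arc (γ P : ℕ) : Set where
    ahead  : γ ≡ P → P ≤ W → Arc γ P
    behind : γ + P ≡ n → P ≤ W → Arc γ P

  arc-≤ᶜ⇔ : ∀ {γ P} → Arc γ P → ∀ m → γ ≤ᶜ 4 * m ⇔ P ≤ 4 * m
  arc-≤ᶜ⇔ {γ} {P} (ahead refl P≤W) m = mk⇔ to′ inj₁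
    where
    to′ : γ ≤ᶜ 4 * m → P ≤ 4 * m
    to′ (inj₁ P≤4m) = P≤4m
    to′ (inj₂ n≤P+4m) with W≤4m⊎W+4m<n m
    ... | inj₁ W≤4m   = ≤-trans P≤W W≤4m
    ... | inj₂ W+4m<n = ⊥-elim (<⇒≱ (≤-<-trans (+-monoˡ-≤ (4 * m) P≤W) W+4m<n) n≤P+4m)
  arc-≤ᶜ⇔ {γ} {P} (behind γ+P≡n P≤W) m =
    mk⇔ to′ (λ P≤4m → inj₂ (subst (_≤ γ + 4 * m) γ+P≡n (+-monoʳ-≤ γ P≤4m)))
    where
    to′ : γ ≤ᶜ 4 * m → P ≤ 4 * m
    to′ (inj₂ n≤γ+4m) = +-cancelˡ-≤ γ P (4 * m) (subst (_≤ γ + 4 * m) (sym γ+P≡n) n≤γ+4m)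
    to′ (inj₁ γ≤4m) with W≤4m⊎W+4m<n m
    ... | inj₁ W≤4m   = ≤-trans P≤W W≤4m
    ... | inj₂ W+4m<n = ⊥-elim (<⇒≱ (≤-<-trans (subst (γ + P ≤_) (+-comm (4 * m) W) (+-mono-≤ γ≤4m P≤W)) W+4m<n)
                                    (≤-reflexive (sym γ+P≡n)))

  InBlock : ℕ → ℕ → Set
  InBlock c P = 4 * c < P × P ≤ 4 * c + 4

  inBlock : ∀ c {r} → r ≤ 3 → InBlock c (4 * c + suc r)
  inBlock c {r} r≤3 = subst (_≤ 4 * c + suc r) (+-comm (4 * c) 1) (+-monoʳ-≤ (4 * c) (s≤s z≤n)) ,
                      +-monoʳ-≤ (4 * c) (s≤s r≤3)

  inBlock-≤4m : ∀ {c P P′} m → InBlock c P → InBlock c P′ → P ≤ 4 * m → P′ ≤ 4 * m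
  inBlock-≤4m {c} m (4c<P , _) (_ , P′≤4c+4) P≤4m = begin
    _          ≤⟨ P′≤4c+4 ⟩
    4 * c + 4  ≡⟨ trans (+-comm (4 * c) 4) (sym (*-suc 4 c)) ⟩
    4 * suc c  ≤⟨ *-monoʳ-≤ 4 (*-cancelˡ-< 4 c m (<-≤-trans 4c<P P≤4m)) ⟩
    4 * m      ∎
    where open ≤-Reasoning

  arcs-sameLevel : ∀ {γ γ′ P P′} c → Arc γ P → Arc γ′ P′ → InBlock c P → InBlock c P′ →
                   SameLevel γ γ′
  arcs-sameLevel c arc arc′ P∈c P′∈c m = mk⇔
    (from (arc-≤ᶜ⇔ arc′ m) ∘ inBlock-≤4m {c} m P∈c P′∈c ∘ to (arc-≤ᶜ⇔ arc m))
    (from (arc-≤ᶜ⇔ arc m) ∘ inBlock-≤4m {c} m P′∈c P∈c ∘ to (arc-≤ᶜ⇔ arc′ m))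

  arc-behind : ∀ {γ P c} → γ < n → γ + P ≋ 0 → c ≤ k → InBlock c P → Arc γ P
  arc-behind {γ} {P} {c} γ<n γ+P≋0 c≤k (4c<P , P≤4c+4) = Data.Sum.[
      (λ γ+P≡0 → ⊥-elim (<⇒≢ (<-≤-trans (s≤s z≤n) 4c<P) (sym (m+n≡0⇒n≡0 γ γ+P≡0)))) ,
      (λ γ+P≡n → behind γ+P≡n P≤W) ]
    (≋-lift γ+P≋0 (+-mono-<-≤ γ<n (<⇒≤ (≤-<-trans P≤W W<n))) (≤-<-trans z≤n γ<n))
    where
    P≤W : P ≤ W
    P≤W = ≤-trans P≤4c+4 (+-monoˡ-≤ 4 (*-monoʳ-≤ 4 c≤k))

  -- Gap t s γ: γ = δ σ v x for the vertex v at offset s and the landmark x at offset t.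
  Gap : ℕ → ℕ → ℕ → Set
  Gap t s γ = γ < n × γ + s ≋ t

  arc-from-ahead : ∀ {t s γ z} → Gap t s γ → t ≡ s + z → t ≤ W → Arc γ z
  arc-from-ahead {s = s} {z = z} (γ<n , γ+s≋t) t≡s+z t≤W = ahead γ≡z z≤W
    where
    z≤W : z ≤ W
    z≤W = ≤-trans (m≤n+m z s) (subst (_≤ W) t≡s+z t≤W)
    γ≡z = ≋⇒≡ (+-cancelʳ-≋ s (≋-trans γ+s≋t (≋-reflexive (trans t≡s+z (+-comm s z)))))
              γ<n (≤-<-trans z≤W W<n)

  arc-from-behind : ∀ {t s γ q c} → Gap t s γ → t + q ≋ 0 → c ≤ k → InBlock c (s + q) →
                    Arc γ (s + q)
  arc-from-behind {t} {s} {γ} {q} (γ<n , γ+s≋t) t+q≋0 = arc-behind γ<n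
    (≋-trans (≋-reflexive (sym (+-assoc γ s q))) (≋-trans (+-congʳ-≋ q γ+s≋t) t+q≋0))

  arc-from-past : ∀ {t s γ P c} → Gap t s γ → s ≡ P + t → c ≤ k → InBlock c P → Arc γ P
  arc-from-past {t} {s} {γ} {P} (γ<n , γ+s≋t) s≡P+t = arc-behind γ<n
    (+-cancelʳ-≋ t (≋-trans (≋-reflexive (trans (+-assoc γ P t) (cong (_+_ γ) (sym s≡P+t)))) γ+s≋t))

  b : ℕ
  b = 2 + 4 * ℓ

  <W⇒≤k : ∀ {c r} → 4 * c + r < W → c ≤ k
  <W⇒≤k {c} {r} 4c+r<W = ≤-pred (*-cancelˡ-< 4 c (suc k)
    (≤-<-trans (m≤m+n (4 * c) r) (subst (4 * c + r <_) W≡4*[1+k] 4c+r<W)))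

  ∸-<-W : ∀ {t} → W < t → t ≤ n → n ∸ t < W
  ∸-<-W {t} W<t t≤n = +-cancelˡ-< W (n ∸ t) W (begin-strict
    W + (n ∸ t)  <⟨ +-monoˡ-< (n ∸ t) W<t ⟩
    t + (n ∸ t)  ≡⟨ m+[n∸m]≡n t≤n ⟩
    n            ≤⟨ n≤8k+8 ⟩
    8 * k + 8    ≡⟨ regroup k ⟩
    W + W        ∎)
    where
    open ≤-Reasoning
    regroup : ∀ k → 8 * k + 8 ≡ (4 * k + 4) + (4 * k + 4)
    regroup = solve-∀

  rem+quot : ∀ r c → r + c * 4 ≡ 4 * c + r
  rem+quot r c = trans (+-comm r (c * 4)) (cong (_+ r) (*-comm c 4))

  -- γ₀, γ₁ are the gaps from a and a + ε, and β₀, β₁, β₂ those from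
  -- a + ε(2+4ℓ), a + ε(3+4ℓ), a + ε(4+4ℓ), to a landmark at offset t.
  module Dichotomy {t γ₀ γ₁ β₀ β₁ β₂ : ℕ} (t<n : t < n) (g₀ : Gap t 0 γ₀) (g₁ : Gap t 1 γ₁)
                   (h₀ : Gap t b β₀) (h₁ : Gap t (1 + b) β₁) (h₂ : Gap t (2 + b) β₂) where

    Triple : Set
    Triple = SameLevel β₀ β₁ × SameLevel β₁ β₂

    triple : ∀ c {P₀ P₁ P₂} → Arc β₀ P₀ → Arc β₁ P₁ → Arc β₂ P₂ →
             InBlock c P₀ → InBlock c P₁ → InBlock c P₂ → Triple
    triple c a₀ a₁ a₂ P₀∈c P₁∈c P₂∈c =
      arcs-sameLevel c a₀ a₁ P₀∈c P₁∈c , arcs-sameLevel c a₁ a₂ P₁∈c P₂∈c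

    pair-ahead : ∀ c r → t ≡ 4 * c + suc (suc r) → r ≤ 2 → t ≤ W → SameLevel γ₀ γ₁
    pair-ahead c r t≡4c+2+r r≤2 t≤W = arcs-sameLevel c
      (arc-from-ahead g₀ t≡4c+2+r t≤W)
      (arc-from-ahead g₁ (trans t≡4c+2+r (+-suc (4 * c) (suc r))) t≤W)
      (inBlock c (s≤s r≤2)) (inBlock c (≤-trans r≤2 (n≤1+n 2)))

    pair-behind : ∀ c r {p} → t + p ≡ n → p ≡ 4 * c + suc r → r ≤ 2 → c ≤ k → SameLevel γ₀ γ₁
    pair-behind c r {p} t+p≡n p≡4c+1+r r≤2 c≤k = arcs-sameLevel c
      (arc-from-behind g₀ t+p≋0 c≤k p∈c) (arc-from-behind g₁ t+p≋0 c≤k 1+p∈c) p∈c 1+p∈c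
      where
      t+p≋0 : t + p ≋ 0
      t+p≋0 = ≋-trans (≋-reflexive t+p≡n) n≋0
      p∈c : InBlock c p
      p∈c = subst (InBlock c) (sym p≡4c+1+r) (inBlock c (≤-trans r≤2 (n≤1+n 2)))
      1+p∈c : InBlock c (1 + p)
      1+p∈c = subst (InBlock c) (sym (trans (cong suc p≡4c+1+r) (sym (+-suc (4 * c) (suc r)))))
                (inBlock c (s≤s r≤2))

    triple-behind : ∀ j → t + 4 * j ≋ 0 → j + ℓ ≤ k → Triple
    triple-behind j t+4j≋0 j+ℓ≤k = triple (j + ℓ)
      (arc-from-behind h₀ t+4j≋0 j+ℓ≤k P₀∈block) (arc-from-behind h₁ t+4j≋0 j+ℓ≤k P₁∈block)
      (arc-from-behind h₂ t+4j≋0 j+ℓ≤k P₂∈block) P₀∈block P₁∈block P₂∈block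
      where
      regroup : ∀ r j ℓ → (suc r + 4 * ℓ) + 4 * j ≡ 4 * (j + ℓ) + suc r
      regroup = solve-∀
      P∈block : ∀ r → r ≤ 3 → InBlock (j + ℓ) ((suc r + 4 * ℓ) + 4 * j)
      P∈block r r≤3 = subst (InBlock (j + ℓ)) (sym (regroup r j ℓ)) (inBlock (j + ℓ) r≤3)
      P₀∈block = P∈block 1 (s≤s z≤n)
      P₁∈block = P∈block 2 (s≤s (s≤s z≤n))
      P₂∈block = P∈block 3 ≤-refl

    triple-ahead : ∀ c → t ≡ 4 * c + 1 → t ≤ W → Triple
    triple-ahead c t≡4c+1 t≤W with ℓ <? c
    ... | yes ℓ<c with m≤n⇒∃[o]m+o≡n ℓ<c
    ...   | e , refl = triple e
      (arc-from-ahead h₀ (trans t≡4c+1 (split₀ ℓ e)) t≤W)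
      (arc-from-ahead h₁ (trans t≡4c+1 (split₁ ℓ e)) t≤W)
      (arc-from-ahead h₂ (trans t≡4c+1 (split₂ ℓ e)) t≤W)
      (inBlock e (s≤s (s≤s z≤n))) (inBlock e (s≤s z≤n)) (inBlock e z≤n)
      where
      split₀ : ∀ ℓ e → 4 * (suc ℓ + e) + 1 ≡ (2 + 4 * ℓ) + (4 * e + 3)
      split₀ = solve-∀
      split₁ : ∀ ℓ e → 4 * (suc ℓ + e) + 1 ≡ (3 + 4 * ℓ) + (4 * e + 2)
      split₁ = solve-∀
      split₂ : ∀ ℓ e → 4 * (suc ℓ + e) + 1 ≡ (4 + 4 * ℓ) + (4 * e + 1)
      split₂ = solve-∀
    triple-ahead c t≡4c+1 t≤W | no ℓ≮c with m≤n⇒∃[o]m+o≡n (≮⇒≥ ℓ≮c)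
    ...   | e , c+e≡ℓ = triple e
      (arc-from-past h₀ (s≡P+t 0) e≤k (inBlock e z≤n))
      (arc-from-past h₁ (s≡P+t 1) e≤k (inBlock e (s≤s z≤n)))
      (arc-from-past h₂ (s≡P+t 2) e≤k (inBlock e (s≤s (s≤s z≤n))))
      (inBlock e z≤n) (inBlock e (s≤s z≤n)) (inBlock e (s≤s (s≤s z≤n)))
      where
      e≤k : e ≤ k
      e≤k = ≤-trans (m≤n+m e c) (≤-trans (≤-reflexive c+e≡ℓ) ℓ≤k)
      regroup : ∀ c e r → suc (suc r) + 4 * (c + e) ≡ (4 * e + suc r) + (4 * c + 1)
      regroup = solve-∀
      s≡P+t : ∀ r → suc (suc r) + 4 * ℓ ≡ (4 * e + suc r) + t
      s≡P+t r = trans (cong (λ x → suc (suc r) + 4 * x) (sym c+e≡ℓ))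
                  (trans (regroup c e r) (cong (_+_ (4 * e + suc r)) (sym t≡4c+1)))

    ahead-cases : t ≤ W → DivMod t 4 → SameLevel γ₀ γ₁ ⊎ Triple
    ahead-cases t≤W (result zero zero t≡0) =
      inj₂ (triple-behind 0 (≋-reflexive (trans (+-identityʳ t) t≡0)) ℓ≤k)
    ahead-cases t≤W (result (suc c) zero t≡) =
      inj₁ (pair-ahead c 2 (trans t≡ (regroup c)) ≤-refl t≤W)
      where
      regroup : ∀ c → suc c * 4 ≡ 4 * c + 4
      regroup = solve-∀
    ahead-cases t≤W (result c (suc zero) t≡) =
      inj₂ (triple-ahead c (trans t≡ (rem+quot 1 c)) t≤W)
    ahead-cases t≤W (result c (suc (suc zero)) t≡) =
      inj₁ (pair-ahead c 0 (trans t≡ (rem+quot 2 c)) z≤n t≤W)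
    ahead-cases t≤W (result c (suc (suc (suc zero))) t≡) =
      inj₁ (pair-ahead c 1 (trans t≡ (rem+quot 3 c)) (s≤s z≤n) t≤W)

    Allowed : Set
    Allowed = ∀ j → k + 1 ∸ ℓ ≤ j → j ≤ k → t + 4 * j ≢ n

    behind-multiple-of-4 : Allowed → ∀ j → t + 4 * j ≡ n → j ≤ k → Triple
    behind-multiple-of-4 allowed j t+4j≡n j≤k with k + 1 ∸ ℓ ≤? j
    ... | yes excluded = ⊥-elim (allowed j excluded j≤k t+4j≡n)
    ... | no ¬excluded = triple-behind j (≋-trans (≋-reflexive t+4j≡n) n≋0) (≤-pred j+ℓ<1+k)
      where
      j+ℓ<1+k : j + ℓ < suc k
      j+ℓ<1+k = subst (suc j + ℓ ≤_) (+-comm k 1)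
                  (m≤o∸n⇒m+n≤o (suc j) (≤-trans ℓ≤k (m≤m+n k 1)) (≰⇒> ¬excluded))

    behind-cases : Allowed → ∀ {p} → t + p ≡ n → p < W → DivMod p 4 →
                   SameLevel γ₀ γ₁ ⊎ Triple
    behind-cases _ t+p≡n _ (result zero zero p≡0) =
      ⊥-elim (<⇒≢ t<n (trans (sym (+-identityʳ t)) (trans (cong (_+_ t) (sym p≡0)) t+p≡n)))
    behind-cases allowed t+p≡n p<W (result (suc j) zero p≡) =
      inj₂ (behind-multiple-of-4 allowed (suc j) (trans (cong (_+_ t) (sym p≡4j)) t+p≡n)
                                 (<W⇒≤k (subst (_< W) p≡4j+0 p<W)))
      where
      p≡4j+0 = trans p≡ (rem+quot 0 (suc j))
      p≡4j = trans p≡4j+0 (+-identityʳ _)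
    behind-cases _ t+p≡n p<W (result c (suc zero) p≡) =
      inj₁ (pair-behind c 0 t+p≡n p≡′ z≤n (<W⇒≤k (subst (_< W) p≡′ p<W)))
      where p≡′ = trans p≡ (rem+quot 1 c)
    behind-cases _ t+p≡n p<W (result c (suc (suc zero)) p≡) =
      inj₁ (pair-behind c 1 t+p≡n p≡′ (s≤s z≤n) (<W⇒≤k (subst (_< W) p≡′ p<W)))
      where p≡′ = trans p≡ (rem+quot 2 c)
    behind-cases _ t+p≡n p<W (result c (suc (suc (suc zero))) p≡) =
      inj₁ (pair-behind c 2 t+p≡n p≡′ (s≤s (s≤s z≤n)) (<W⇒≤k (subst (_< W) p≡′ p<W)))
      where p≡′ = trans p≡ (rem+quot 3 c)

    dichotomy : Allowed → SameLevel γ₀ γ₁ ⊎ Triple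
    dichotomy allowed with t ≤? W
    ... | yes t≤W = ahead-cases t≤W (t divMod 4)
    ... | no t≰W =
      behind-cases allowed (m+[n∸m]≡n (<⇒≤ t<n)) (∸-<-W (≰⇒> t≰W) (<⇒≤ t<n)) ((n ∸ t) divMod 4)

  module Landmarks (σ : Orientation) (a : Fin n) where

    v₁ : Fin n
    v₁ = shift n a (sign σ)

    at : ℕ → Fin n
    at s = shift n a (sign σ ℤ.* + s)

    forbidden : ℕ → Fin n
    forbidden j = shift n a (- (sign σ ℤ.* + (4 * j)))

    offset<n : ∀ {s} → s ≤ 2 + b → s < n
    offset<n s≤2+b = ≤-<-trans (≤-trans s≤2+b (+-monoʳ-≤ 4 (*-monoʳ-≤ 4 ℓ≤k)))
                               (subst (_< n) (+-comm (4 * k) 4) W<n)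

    offset-v₁ : δ σ a v₁ ≡ 1
    offset-v₁ = subst (λ z → δ σ a (shift n a z) ≡ 1) (ℤₚ.*-identityʳ (sign σ))
                      (δ-shift σ a (offset<n (s≤s z≤n)))

    offset-at : ∀ {s} → s ≤ 2 + b → δ σ a (at s) ≡ s
    offset-at s≤2+b = δ-shift σ a (offset<n s≤2+b)

    gap : ∀ x {v s} → δ σ a v ≡ s → Gap (δ σ a x) s (δ σ v x)
    gap x {v} refl = δ<n σ v x , ≋-trans (≋-reflexive (+-comm (δ σ v x) (δ σ a v))) (δ-+ σ a v x)

    reaching-forbidden : ∀ {x j} → j ≤ k → δ σ a x + 4 * j ≡ n → x ≡ forbidden j
    reaching-forbidden {x} {j} j≤k t+4j≡n =
      δ-injectiveˡ σ (trans x→a≡4j (sym (δ-shift-neg σ a 4j<n)))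
      where
      4j<n : 4 * j < n
      4j<n = ≤-<-trans (≤-trans (*-monoʳ-≤ 4 j≤k) (m≤m+n (4 * k) 4)) W<n
      x→a+t≋4j+t : δ σ x a + δ σ a x ≋ 4 * j + δ σ a x
      x→a+t≋4j+t = ≋-trans (δ-+-inverse σ x a)
        (≋-sym (≋-trans (≋-reflexive (trans (+-comm (4 * j) (δ σ a x)) t+4j≡n)) n≋0))
      x→a≡4j : δ σ x a ≡ 4 * j
      x→a≡4j = ≋⇒≡ (+-cancelʳ-≋ (δ σ a x) x→a+t≋4j+t) (δ<n σ x a) 4j<n

    Triangle : Fin n → Set
    Triangle x = Equidistant x (at b) (at (1 + b)) × Equidistant x (at (1 + b)) (at (2 + b)) ×
                 Equidistant x (at b) (at (2 + b))

    pair-or-triangle : ∀ x → (∀ j → k + 1 ∸ ℓ ≤ j → j ≤ k → δ σ a x + 4 * j ≢ n) →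
                       Equidistant x a v₁ ⊎ Triangle x
    pair-or-triangle x allowed = Data.Sum.map (sameLevel⇒equidistant σ) triangle
      (Dichotomy.dichotomy (δ<n σ a x) (gap x (δ-self σ a)) (gap x offset-v₁)
        (gap x (offset-at (m≤n+m b 2))) (gap x (offset-at (m≤n+m (1 + b) 1))) (gap x (offset-at ≤-refl))
        allowed)
      where
      triangle : SameLevel (δ σ (at b) x) (δ σ (at (1 + b)) x) ×
                 SameLevel (δ σ (at (1 + b)) x) (δ σ (at (2 + b)) x) → Triangle x
      triangle (same₀₁ , same₁₂) = sameLevel⇒equidistant σ same₀₁ , sameLevel⇒equidistant σ same₁₂ ,
                                   sameLevel⇒equidistant σ (sameLevel-trans same₀₁ same₁₂)

    adjacent-offsets : ∀ s d → 1 ≤ d → d ≤ 2 → d + s ≤ 2 + b →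
                       Adj n (at s) (at (d + s)) × Adj n (at (d + s)) (at s)
    adjacent-offsets s d 1≤d d≤2 d+s≤2+b = δ-adjacent σ 1≤d (≤-trans d≤2 (m≤m+n 2 2)) d<n
      (δ-between σ (offset-at (m+n≤o⇒n≤o d d+s≤2+b)) (trans (offset-at d+s≤2+b) (+-comm d s)) d<n)
      where
      d<n : d < n
      d<n = offset<n (≤-trans d≤2 (m≤m+n 2 b))

    triangle-pair : ∀ x → Equidistant x (at b) (at (1 + b)) ⊎ Equidistant x (at (1 + b)) (at (2 + b)) ⊎
                            Equidistant x (at b) (at (2 + b))
    triangle-pair x = triangle-equidistant x (adjacent-offsets b 1 (s≤s z≤n) (s≤s z≤n) (n≤1+n _))
      (adjacent-offsets (1 + b) 1 (s≤s z≤n) (s≤s z≤n) ≤-refl) (adjacent-offsets b 2 (s≤s z≤n) ≤-refl ≤-refl)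

    offsets-differ : ∀ {u v s s′} → δ σ a u ≡ s → δ σ a v ≡ s′ → s ≢ s′ → u ≢ v
    offsets-differ a→u≡s a→v≡s′ s≢s′ refl = s≢s′ (trans (sym a→u≡s) a→v≡s′)

    Blocks : List (List (Fin n))
    Blocks = (a ∷ v₁ ∷ []) ∷ (at b ∷ at (1 + b) ∷ at (2 + b) ∷ []) ∷ []

    resolving⇒3≤∣X∣ : ∀ X → (∀ j → k + 1 ∸ ℓ ≤ j → j ≤ k → forbidden j ∉ X) → Resolves n X Blocks →
                      3 ≤ ∣ X ∣
    resolving⇒3≤∣X∣ X avoids resolves = ≮⇒≥ λ ∣X∣<3 → unresolved
      (subset-common-choice X (≤-pred ∣X∣<3) (λ {x} → pair-or-triangle x ∘ allowed)
                                             (λ {x} _ → triangle-pair x))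
      where
      allowed : ∀ {x} → x ∈ X → ∀ j → k + 1 ∸ ℓ ≤ j → j ≤ k → δ σ a x + 4 * j ≢ n
      allowed x∈X j lo j≤k t+4j≡n = avoids j lo j≤k (subst (_∈ X) (reaching-forbidden j≤k t+4j≡n) x∈X)
      separated : ∀ {B u v} → B ∈ₗ Blocks → u ∈ₗ B → v ∈ₗ B → u ≢ v →
                  ¬ (∀ {x} → x ∈ X → Equidistant x u v)
      separated B∈ u∈B v∈B u≢v same = resolves _ B∈ _ _ u∈B v∈B u≢v (equidistant⇒sameRep (λ _ → same))
      b<1+b : b < 1 + b
      b<1+b = m<n+m b {1} (s≤s z≤n)
      unresolved : (∀ {x} → x ∈ X → Equidistant x a v₁) ⊎ (∀ {x} → x ∈ X → Equidistant x (at b) (at (1 + b))) ⊎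
                   (∀ {x} → x ∈ X → Equidistant x (at (1 + b)) (at (2 + b))) ⊎
                   (∀ {x} → x ∈ X → Equidistant x (at b) (at (2 + b))) → ⊥
      unresolved (inj₁ same) = separated (here refl) (here refl) (there (here refl))
        (offsets-differ (δ-self σ a) offset-v₁ λ ()) same
      unresolved (inj₂ (inj₁ same)) = separated (there (here refl)) (here refl) (there (here refl))
        (offsets-differ (offset-at (m≤n+m b 2)) (offset-at (m≤n+m (1 + b) 1)) (<⇒≢ b<1+b)) same
      unresolved (inj₂ (inj₂ (inj₁ same))) =
        separated (there (here refl)) (there (here refl)) (there (there (here refl)))
        (offsets-differ (offset-at (m≤n+m (1 + b) 1)) (offset-at ≤-refl) (<⇒≢ (s≤s b<1+b))) same
      unresolved (inj₂ (inj₂ (inj₂ same))) =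
        separated (there (here refl)) (here refl) (there (there (here refl)))
        (offsets-differ (offset-at (m≤n+m b 2)) (offset-at ≤-refl) (<⇒≢ (<-trans b<1+b (s≤s b<1+b)))) same

size-bounds : ∀ {n k r} → r ≡ 7 ⊎ r ≡ 8 → n ≡ 8 * k + r → 8 * k + 7 ≤ n × n ≤ 8 * k + 8
size-bounds (inj₁ refl) refl = ≤-refl , +-monoʳ-≤ _ (n≤1+n 7)
size-bounds (inj₂ refl) refl = +-monoʳ-≤ _ (n≤1+n 7) , ≤-refl

lemma3p8 : (n k r : ℕ) .{{_ : NonZero n}} → 1 ≤ k → (r ≡ 7 ⊎ r ≡ 8) → n ≡ 8 * k + r →
    (a : Fin n) → (ℓ : ℕ) → 1 ≤ ℓ → ℓ ≤ k → (ε : ℤ) → (ε ≡ ℤ.1ℤ ⊎ ε ≡ ℤ.-1ℤ) →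
    (S X : Subset n) →
    IsCluster n S ((a ∷ shift n a ε ∷ [])
                   ∷ (shift n a (ε ℤ.* + (2 + 4 * ℓ)) ∷ shift n a (ε ℤ.* + (3 + 4 * ℓ)) ∷ shift n a (ε ℤ.* + (4 + 4 * ℓ)) ∷ [])
                   ∷ []) →
    (∀ j → k + 1 ∸ ℓ ≤ j → j ≤ k → shift n a (- (ε ℤ.* + (4 * j))) ∉ X) →
    Resolves n X ((a ∷ shift n a ε ∷ [])
                   ∷ (shift n a (ε ℤ.* + (2 + 4 * ℓ)) ∷ shift n a (ε ℤ.* + (3 + 4 * ℓ)) ∷ shift n a (ε ℤ.* + (4 + 4 * ℓ)) ∷ [])
                   ∷ []) →
    3 ≤ ∣ X ∣
lemma3p8 n k r _ r∈78 n≡8k+r a ℓ _ ℓ≤k _ (inj₁ refl) _ X _ = Landmarks.resolving⇒3≤∣X∣ forward a X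
  where open Offsets n k ℓ (proj₁ (size-bounds {k = k} r∈78 n≡8k+r))
                           (proj₂ (size-bounds {k = k} r∈78 n≡8k+r)) ℓ≤k
lemma3p8 n k r _ r∈78 n≡8k+r a ℓ _ ℓ≤k _ (inj₂ refl) _ X _ = Landmarks.resolving⇒3≤∣X∣ backward a X
  where open Offsets n k ℓ (proj₁ (size-bounds {k = k} r∈78 n≡8k+r))
                           (proj₂ (size-bounds {k = k} r∈78 n≡8k+r)) ℓ≤k
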